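{- The map sending a binary quadratic form $Q(u,v)=au^2+buv+cv^2\in\mathbb{Z}[u,v]$ with $b^2-4ac\neq0$ and $a\neq0$ to the pair $(R,I)$, where $R=\langle 1,\tau\rangle$ is the oriented quadratic ring of discriminant $D=b^2-4ac$ with $\tau$ the element such that $[1,\tau]$ is positively oriented and $\tau^2+b\tau+ac=0$, and $I=\langle a,\tau\rangle$ is the oriented ideal with orientation given by the ordered basis $[a,\tau]$, induces a bijection $$B'_2(\mathbb{Z})\backslash\{Q=au^2+buv+cv^2: b^2-4ac\neq0,\ a\neq0\}\longrightarrow \mathrm{Iso}\backslash\{(R,I): R/I\cong\mathbb{Z}/\mathrm{N}(I)\mathbb{Z}\},$$ where $R$ runs over non-degenerate oriented quadratic rings and $I$ over oriented ideals of $R$ with cyclic quotient, and an isomorphism $(R_1,I_1)\to(R_2,I_2)$ is an orientation-preserving ring isomorphism $R_1\to R_2$ sending $I_1$ to $I_2$.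
   Context: $B'_2(\mathbb{Z})$ is the group of lower-triangular matrices in $\mathrm{SL}_2(\mathbb{Z})$ with positive diagonal entries (i.e. $\begin{pmatrix}1&0\\k&1\end{pmatrix}$, $k\in\mathbb{Z}$); $g=\begin{pmatrix}\alpha&\beta\\\gamma&\delta\end{pmatrix}$ acts on binary quadratic forms by $(g\cdot Q)(u,v)=Q(\alpha u+\gamma v,\beta u+\delta v)$. For $D\neq0$, $D\equiv0,1\pmod4$, the quadratic ring $R(D)$ has $\mathbb{Z}$-basis $[1,\tau_D]$ with $\tau_D^2=D/4$ (if $D\equiv0\bmod 4$) or $\tau_D^2=\frac{D-1}{4}+\tau_D$ (if $D\equiv1\bmod 4$); it is oriented by the fixed choice of $\tau_D$, and a basis $[1,\tau]$ is positively oriented if the change-of-basis matrix between $[1,\tau]$ and $[1,\tau_D]$ has positive determinant. An oriented ideal is a pair $(I,\epsilon)$ with $I$ an ideal and $\epsilon=\pm1$; an ideal with ordered basis $[\alpha,\beta]$ is oriented by the sign of the determinant of the matrix expressing $[\alpha,\beta]$ in terms of $[1,\tau_D]$. $\mathrm{N}(I)=|R/I|$. -}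

module Defs where

open import Data.Integer using (ℤ; +_; -_; _+_; _-_; _*_; _<_)
open import Data.Product using (Σ; ∃; ∃-syntax; _×_; _,_)
open import Data.Sum using (_⊎_)
open import Relation.Binary.PropositionalEquality using (_≡_; _≢_)
open import Relation.Nullary using (¬_)
open import Function.Bundles using (_⇔_)
open import Function.Definitions using (Bijective)

record Form : Set where
  constructor form
  field
    a b c : ℤ

open Form public

discF : Form → ℤ
discF Q = b Q * b Q - + 4 * (a Q * c Q)

ValidForm : Form → Set
ValidForm Q = (discF Q ≢ + 0) × (a Q ≢ + 0)

-- 2×2 integer matrices g = (α β ; γ δ)
record Mat : Set where
  constructor mat
  field
    mα mβ mγ mδ : ℤ

open Mat public

-- (g·Q)(u,v) = Q(αu+γv, βu+δv), written out on coefficients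
act : Mat → Form → Form
act g Q = form
  (a Q * (mα g * mα g) + b Q * (mα g * mβ g) + c Q * (mβ g * mβ g))
  (+ 2 * (a Q * (mα g * mγ g)) + b Q * (mα g * mδ g + mβ g * mγ g)
     + + 2 * (c Q * (mβ g * mδ g)))
  (a Q * (mγ g * mγ g) + b Q * (mγ g * mδ g) + c Q * (mδ g * mδ g))

InB2' : Mat → Set
InB2' g = (mβ g ≡ + 0) × (+ 0 < mα g) × (+ 0 < mδ g)
          × (mα g * mδ g - mβ g * mγ g ≡ + 1)

FormEquiv : Form → Form → Set
FormEquiv Q Q' = ∃[ g ] (InB2' g × act g Q ≡ Q')

-- Oriented quadratic rings.  R_{t,n} = ℤ[x]/(x² - t x + n), with elements
-- written (u , v) = u + v x in the basis [1, x], oriented by [1, x].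

Elt : Set
Elt = ℤ × ℤ

_⊕_ : Elt → Elt → Elt
(u₁ , v₁) ⊕ (u₂ , v₂) = (u₁ + u₂ , v₁ + v₂)

_·_ : ℤ → Elt → Elt
k · (u , v) = (k * u , k * v)

_⊖_ : Elt → Elt → Elt
x ⊖ y = x ⊕ ((- + 1) · y)

mulR : ℤ → ℤ → Elt → Elt → Elt
mulR t n (u₁ , v₁) (u₂ , v₂) =
  (u₁ * u₂ - n * (v₁ * v₂) , u₁ * v₂ + u₂ * v₁ + t * (v₁ * v₂))

oneR : Elt
oneR = (+ 1 , + 0)

xR : Elt
xR = (+ 0 , + 1)

discR : ℤ → ℤ → ℤ
discR t n = t * t - + 4 * n

det : Elt → Elt → ℤ
det (u₁ , v₁) (u₂ , v₂) = u₁ * v₂ - v₁ * u₂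

InSpan : Elt → Elt → Elt → Set
InSpan e₁ e₂ s = ∃[ m ] ∃[ k ] (s ≡ (m · e₁) ⊕ (k · e₂))

-- A pair (R, I): ring R_{t,n} together with a (full rank) sublattice
-- I = ⟨g₁, g₂⟩ given by an ordered basis, oriented by sign det(g₁,g₂).

record Pair : Set where
  constructor pair
  field
    pt pn : ℤ
    g₁ g₂ : Elt

open Pair public

_∈I_ : Elt → Pair → Set
s ∈I P = InSpan (g₁ P) (g₂ P) s

ringMul : Pair → Elt → Elt → Elt
ringMul P = mulR (pt P) (pn P)

IsIdeal : Pair → Set
IsIdeal P = ∀ r s → s ∈I P → ringMul P r s ∈I P

-- R/I is cyclic (I has finite index, so R/I ≅ ℤ/N(I)ℤ)
CyclicQuotient : Pair → Set
CyclicQuotient P = ∃[ g ] ∀ s → ∃[ k ] ((s ⊖ (k · g)) ∈I P)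

ValidPair : Pair → Set
ValidPair P = (discR (pt P) (pn P) ≢ + 0)
            × (det (g₁ P) (g₂ P) ≢ + 0)
            × IsIdeal P
            × CyclicQuotient P

SameSign : ℤ → ℤ → Set
SameSign d₁ d₂ = ((+ 0 < d₁) × (+ 0 < d₂)) ⊎ ((d₁ < + 0) × (d₂ < + 0))

PairIso : Pair → Pair → Set
PairIso P₁ P₂ = Σ (Elt → Elt) λ f →
    (f oneR ≡ oneR)
  × (∀ x y → f (x ⊕ y) ≡ f x ⊕ f y)
  × (∀ x y → f (ringMul P₁ x y) ≡ ringMul P₂ (f x) (f y))
  × Bijective _≡_ _≡_ f
  × (+ 0 < det (f oneR) (f xR))
  × (∀ s → (s ∈I P₁) ⇔ (f s ∈I P₂))
  × SameSign (det (g₁ P₁) (g₂ P₁)) (det (g₁ P₂) (g₂ P₂))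

-- The map Q ↦ (R, I): R = ⟨1, τ⟩ with τ² + bτ + ac = 0 (i.e. t = -b,
-- n = ac, τ = x), I = ⟨a, τ⟩ with ordered basis [a, τ].

formToPair : Form → Pair
formToPair Q = pair (- b Q) (a Q * c Q) (a Q , + 0) xR

module Submission where

-- The form (a, b, c) gives the ring with x² = -b x - a c and the ideal aℤ + xℤ, i.e. the
-- elements u + v x with a ∣ u. Conversely, an ideal I with cyclic quotient contains some
-- r + x (the quotient is then generated by 1), hence consists of the u + v x with
-- det I ∣ u - r v; after the translation x ↦ x + r it is the ideal of the form
-- (det I, -(t + 2r), N(r + x) / det I). An orientation-preserving ring isomorphism fixes 1
-- and sends x to x + s; it carries the ideal of (a, b, c) onto that of (a', b', c')
-- exactly when a' = ±a and a ∣ s, and the orientations of the ideals force a' = a.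
-- Writing s = γ a, comparing x² on both sides gives (a', b', c') = Q(u + γ v, v), the
-- action of (1 0; γ 1) ∈ B'₂(ℤ).

open import Defs

open import Data.Integer
  using (ℤ; +_; -_; _+_; _-_; _*_; _<_; +<+; -<+; -[1+_]; sign; ≢-nonZero)
open import Data.Integer.Properties
  using (◃-cong; +-identityˡ; <-cmp; *-identityʳ; *-cancelˡ-≡; *-comm; neg-injective; neg-involutive; +-0-abelianGroup)
open import Algebra.Properties.AbelianGroup +-0-abelianGroup
  using () renaming (∙-cancelˡ to +-cancelˡ; ∙-cancelʳ to +-cancelʳ)
open import Data.Integer.Divisibility.Signed
  using (_∣_; divides; ∣⇒∣ᵤ; ∣-refl; ∣m∣n⇒∣m+n; ∣m+n∣n⇒∣m; ∣m∣n⇒∣m-n; ∣n⇒∣m*n; ∣m⇒∣m*n)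
open import Data.Integer.Tactic.RingSolver using (solve-∀)
import Data.Nat as ℕ
import Data.Nat.Divisibility as ℕ
open import Data.Product using (∃-syntax; _×_; _,_; proj₁; proj₂)
open import Data.Sum using (inj₁; inj₂)
open import Data.Empty using (⊥-elim)
open import Function.Base using (_∘_; id)
open import Function.Bundles using (_⇔_; mk⇔; Equivalence)
open import Function.Construct.Composition using (_⇔-∘_)
open import Function.Construct.Symmetry using (⇔-sym)
open import Function.Definitions using (Surjective; Bijective)
open import Function.Consequences.Propositional using (inverseᵇ⇒bijective)
open import Relation.Binary.Definitions using (tri<; tri≈; tri>)
open import Relation.Binary.PropositionalEquality
open ≡-Reasoning

subst-⇔ : ∀ {A : Set} (P : A → Set) {x y} → x ≡ y → P x ⇔ P y
subst-⇔ P refl = mk⇔ id id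

sameSign-refl : ∀ {i} → i ≢ + 0 → SameSign i i
sameSign-refl {i} i≢0 with <-cmp (+ 0) i
... | tri< 0<i _ _ = inj₁ (0<i , 0<i)
... | tri≈ _ 0≡i _ = ⊥-elim (i≢0 (sym 0≡i))
... | tri> _ _ i<0 = inj₂ (i<0 , i<0)

sameSign⇒sign≡ : ∀ {i j} → SameSign i j → sign i ≡ sign j
sameSign⇒sign≡ (inj₁ (+<+ _ , +<+ _)) = refl
sameSign⇒sign≡ (inj₂ (-<+ , -<+)) = refl

∣-antisym-sameSign : ∀ {i j} → SameSign i j → i ∣ j → j ∣ i → i ≡ j
∣-antisym-sameSign ss i∣j j∣i =
  ◃-cong (sameSign⇒sign≡ ss) (ℕ.∣-antisym (∣⇒∣ᵤ i∣j) (∣⇒∣ᵤ j∣i))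

positive-∣1⇒≡1 : ∀ {e} → + 0 < e → e ∣ + 1 → e ≡ + 1
positive-∣1⇒≡1 (+<+ _) e∣1 = cong +_ (ℕ.∣1⇒≡1 (∣⇒∣ᵤ e∣1))

∣⇔∣+ : ∀ {d m} n → d ∣ n → d ∣ m ⇔ d ∣ m + n
∣⇔∣+ n d∣n = mk⇔ (λ d∣m → ∣m∣n⇒∣m+n d∣m d∣n) (λ d∣m+n → ∣m+n∣n⇒∣m d∣m+n d∣n)

⊕-cancelʳ : ∀ x y z → x ⊕ z ≡ y ⊕ z → x ≡ y
⊕-cancelʳ (x₁ , x₂) (y₁ , y₂) (z₁ , z₂) eq =
  cong₂ _,_ (+-cancelʳ z₁ x₁ y₁ (cong proj₁ eq)) (+-cancelʳ z₂ x₂ y₂ (cong proj₂ eq))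

⊕-identityˡ : ∀ x → (+ 0 , + 0) ⊕ x ≡ x
⊕-identityˡ (x₁ , x₂) = cong₂ _,_ (+-identityˡ x₁) (+-identityˡ x₂)

·-inverseˡ : ∀ k y → ((- k) · y) ⊕ (k · y) ≡ (+ 0 , + 0)
·-inverseˡ k (y₁ , y₂) = cong₂ _,_ (inverse k y₁) (inverse k y₂)
  where
  inverse : ∀ k y → (- k) * y + k * y ≡ + 0
  inverse = solve-∀

suc-· : ∀ n y → (+ ℕ.suc n) · y ≡ y ⊕ ((+ n) · y)
suc-· n (y₁ , y₂) = cong₂ _,_ (suc-* (+ n) y₁) (suc-* (+ n) y₂)
  where
  suc-* : ∀ n y → (+ 1 + n) * y ≡ y + n * y
  suc-* = solve-∀

additive⇒linear : ∀ (f : Elt → Elt) → (∀ x y → f (x ⊕ y) ≡ f x ⊕ f y) →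
                  ∀ u v → f (u , v) ≡ (u · f oneR) ⊕ (v · f xR)
additive⇒linear f f-⊕ u v = begin
  f (u , v)                       ≡⟨ cong f (cong₂ _,_ (coordinate₁ u v) (coordinate₂ u v)) ⟩
  f ((u · oneR) ⊕ (v · xR))       ≡⟨ f-⊕ (u · oneR) (v · xR) ⟩
  f (u · oneR) ⊕ f (v · xR)       ≡⟨ cong₂ _⊕_ (f-· u oneR) (f-· v xR) ⟩
  (u · f oneR) ⊕ (v · f xR)       ∎
  where
  coordinate₁ : ∀ u v → u ≡ u * + 1 + v * + 0
  coordinate₁ = solve-∀
  coordinate₂ : ∀ u v → v ≡ u * + 0 + v * + 1
  coordinate₂ = solve-∀

  f-zero : f (+ 0 , + 0) ≡ (+ 0 , + 0)
  f-zero = ⊕-cancelʳ _ _ (f (+ 0 , + 0))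
    (trans (sym (f-⊕ (+ 0 , + 0) (+ 0 , + 0))) (sym (⊕-identityˡ (f (+ 0 , + 0)))))

  f-·ℕ : ∀ n y → f ((+ n) · y) ≡ (+ n) · f y
  f-·ℕ ℕ.zero    y = f-zero
  f-·ℕ (ℕ.suc n) y = begin
    f ((+ ℕ.suc n) · y)     ≡⟨ cong f (suc-· n y) ⟩
    f (y ⊕ ((+ n) · y))     ≡⟨ f-⊕ y ((+ n) · y) ⟩
    f y ⊕ f ((+ n) · y)     ≡⟨ cong (f y ⊕_) (f-·ℕ n y) ⟩
    f y ⊕ ((+ n) · f y)     ≡⟨ suc-· n (f y) ⟨
    (+ ℕ.suc n) · f y       ∎

  f-· : ∀ k y → f (k · y) ≡ k · f y
  f-· (+ n)    y = f-·ℕ n y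
  f-· -[1+ n ] y = ⊕-cancelʳ _ _ ((+ ℕ.suc n) · f y) (begin
    f (-[1+ n ] · y) ⊕ ((+ ℕ.suc n) · f y)   ≡⟨ cong (f (-[1+ n ] · y) ⊕_) (f-·ℕ (ℕ.suc n) y) ⟨
    f (-[1+ n ] · y) ⊕ f ((+ ℕ.suc n) · y)   ≡⟨ f-⊕ (-[1+ n ] · y) ((+ ℕ.suc n) · y) ⟨
    f ((-[1+ n ] · y) ⊕ ((+ ℕ.suc n) · y))   ≡⟨ cong f (·-inverseˡ (+ ℕ.suc n) y) ⟩
    f (+ 0 , + 0)                             ≡⟨ f-zero ⟩
    (+ 0 , + 0)                               ≡⟨ ·-inverseˡ (+ ℕ.suc n) (f y) ⟨
    (-[1+ n ] · f y) ⊕ ((+ ℕ.suc n) · f y)   ∎)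

shift : ℤ → Elt → Elt
shift s (u , v) = (u + s * v , v)

shift-⊕ : ∀ s x y → shift s (x ⊕ y) ≡ shift s x ⊕ shift s y
shift-⊕ s (u₁ , v₁) (u₂ , v₂) = cong₂ _,_ (distrib s u₁ v₁ u₂ v₂) refl
  where
  distrib : ∀ s u₁ v₁ u₂ v₂ → u₁ + u₂ + s * (v₁ + v₂) ≡ (u₁ + s * v₁) + (u₂ + s * v₂)
  distrib = solve-∀

shift-mulR : ∀ t n s x y → shift s (mulR t n x y)
           ≡ mulR (t - (s + s)) (n - s * t + s * s) (shift s x) (shift s y)
shift-mulR t n s (u₁ , v₁) (u₂ , v₂) = cong₂ _,_ (coordinate₁ t n s u₁ v₁ u₂ v₂) (coordinate₂ t s u₁ v₁ u₂ v₂)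
  where
  coordinate₁ : ∀ t n s u₁ v₁ u₂ v₂ →
    u₁ * u₂ - n * (v₁ * v₂) + s * (u₁ * v₂ + u₂ * v₁ + t * (v₁ * v₂))
    ≡ (u₁ + s * v₁) * (u₂ + s * v₂) - (n - s * t + s * s) * (v₁ * v₂)
  coordinate₁ = solve-∀
  coordinate₂ : ∀ t s u₁ v₁ u₂ v₂ →
    u₁ * v₂ + u₂ * v₁ + t * (v₁ * v₂)
    ≡ (u₁ + s * v₁) * v₂ + (u₂ + s * v₂) * v₁ + (t - (s + s)) * (v₁ * v₂)
  coordinate₂ = solve-∀

shift-inverseˡ : ∀ s x → shift (- s) (shift s x) ≡ x
shift-inverseˡ s (u , v) = cong₂ _,_ (cancel s u v) refl
  where
  cancel : ∀ s u v → u + s * v + (- s) * v ≡ u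
  cancel = solve-∀

shift-bijective : ∀ s → Bijective _≡_ _≡_ (shift s)
shift-bijective s = inverseᵇ⇒bijective
  ((λ {y} {x} x≡ → trans (cong (shift s) x≡) (shift-inverseʳ y)) ,
   (λ {x} {y} y≡ → trans (cong (shift (- s)) y≡) (shift-inverseˡ s x)))
  where
  shift-inverseʳ : ∀ y → shift s (shift (- s) y) ≡ y
  shift-inverseʳ y = trans (cong (λ r → shift r (shift (- s) y)) (sym (neg-involutive s)))
                           (shift-inverseˡ (- s) y)

∈span-⊕ : ∀ {e₁ e₂ x y} → InSpan e₁ e₂ x → InSpan e₁ e₂ y → InSpan e₁ e₂ (x ⊕ y)
∈span-⊕ {p , q} {p' , q'} (m , k , refl) (m' , k' , refl) =
  m + m' , k + k' , cong₂ _,_ (collect m k m' k' p p') (collect m k m' k' q q')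
  where
  collect : ∀ m k m' k' p p' → m * p + k * p' + (m' * p + k' * p') ≡ (m + m') * p + (k + k') * p'
  collect = solve-∀

∈span-· : ∀ {e₁ e₂ x} c → InSpan e₁ e₂ x → InSpan e₁ e₂ (c · x)
∈span-· {p , q} {p' , q'} c (m , k , refl) =
  c * m , c * k , cong₂ _,_ (distrib c m k p p') (distrib c m k q q')
  where
  distrib : ∀ c m k p p' → c * (m * p + k * p') ≡ c * m * p + c * k * p'
  distrib = solve-∀

det-∈span : ∀ e₁ e₂ → InSpan e₁ e₂ (det e₁ e₂ , + 0)
det-∈span (p , q) (p' , q') = q' , - q , cong₂ _,_ (expand p q p' q') (cancel q q')
  where
  expand : ∀ p q p' q' → p * q' - q * p' ≡ q' * p + (- q) * p'
  expand = solve-∀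
  cancel : ∀ q q' → + 0 ≡ q' * q + (- q) * q'
  cancel = solve-∀

det-∣-det : ∀ {e₁ e₂ x y} → InSpan e₁ e₂ x → InSpan e₁ e₂ y → det e₁ e₂ ∣ det x y
det-∣-det {p , q} {p' , q'} (α , β , refl) (λ' , μ , refl) =
  divides (α * μ - β * λ') (multiplicative α β λ' μ p q p' q')
  where
  multiplicative : ∀ α β λ' μ p q p' q' →
    (α * p + β * p') * (λ' * q + μ * q') - (α * q + β * q') * (λ' * p + μ * p')
    ≡ (α * μ - β * λ') * (p * q' - q * p')
  multiplicative = solve-∀

∈span⇔∣ : ∀ {e₁ e₂ r} → InSpan e₁ e₂ (r , + 1) →
          ∀ u v → InSpan e₁ e₂ (u , v) ⇔ det e₁ e₂ ∣ u - r * v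
∈span⇔∣ {e₁} {e₂} {r} r+x∈ u v = mk⇔ to from
  where
  to : InSpan e₁ e₂ (u , v) → det e₁ e₂ ∣ u - r * v
  to uv∈ = subst (det e₁ e₂ ∣_) (det-with-r+x u v r) (det-∣-det uv∈ r+x∈)
    where
    det-with-r+x : ∀ u v r → u * + 1 - v * r ≡ u - r * v
    det-with-r+x = solve-∀
  from : det e₁ e₂ ∣ u - r * v → InSpan e₁ e₂ (u , v)
  from (divides k eq) = subst (InSpan e₁ e₂) (sym decomposition)
    (∈span-⊕ (∈span-· k (det-∈span e₁ e₂)) (∈span-· v r+x∈))
    where
    split : ∀ u v r → u ≡ (u - r * v) + v * r
    split = solve-∀
    coordinate₂ : ∀ k v → v ≡ k * + 0 + v * + 1
    coordinate₂ = solve-∀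
    decomposition : (u , v) ≡ (k · (det e₁ e₂ , + 0)) ⊕ (v · (r , + 1))
    decomposition = cong₂ _,_ (trans (split u v r) (cong (_+ v * r) eq)) (coordinate₂ k v)

det-formToPair : ∀ Q → det (g₁ (formToPair Q)) (g₂ (formToPair Q)) ≡ a Q
det-formToPair Q = identity (a Q)
  where
  identity : ∀ a → a * + 1 - + 0 * + 0 ≡ a
  identity = solve-∀

∈formToPair⇔∣ : ∀ Q u v → ((u , v) ∈I formToPair Q) ⇔ a Q ∣ u
∈formToPair⇔∣ Q u v = mk⇔ to from
  where
  drop : ∀ m k a → m * a + k * + 0 ≡ m * a
  drop = solve-∀
  coordinate₂ : ∀ m v → v ≡ m * + 0 + v * + 1
  coordinate₂ = solve-∀
  to : (u , v) ∈I formToPair Q → a Q ∣ u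
  to (m , k , eq) = divides m (trans (cong proj₁ eq) (drop m k (a Q)))
  from : a Q ∣ u → (u , v) ∈I formToPair Q
  from (divides m eq) = m , v , cong₂ _,_ (trans eq (sym (drop m v (a Q)))) (coordinate₂ m v)

mulR-square-injective : ∀ {t n t' n'} σ →
  mulR t n (σ , + 1) (σ , + 1) ≡ mulR t' n' (σ , + 1) (σ , + 1) → t ≡ t' × n ≡ n'
mulR-square-injective {t} {n} {t'} {n'} σ eq =
  cancel t t' (+-cancelˡ (σ * + 1 + σ * + 1) (t * + 1) (t' * + 1) (cong proj₂ eq)) ,
  cancel n n' (neg-injective (+-cancelˡ (σ * σ) (- (n * + 1)) (- (n' * + 1)) (cong proj₁ eq)))
  where
  cancel : ∀ m m' → m * + 1 ≡ m' * + 1 → m ≡ m'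
  cancel m m' eq = trans (sym (*-identityʳ m)) (trans eq (*-identityʳ m'))

shift-pairIso : ∀ {P P'} s → pt P' ≡ pt P - (s + s) → pn P' ≡ pn P - s * pt P + s * s →
                (∀ w → (w ∈I P) ⇔ (shift s w ∈I P')) →
                SameSign (det (g₁ P) (g₂ P)) (det (g₁ P') (g₂ P')) → PairIso P P'
shift-pairIso {pair t n _ _} {pair _ _ _ _} s refl refl ∈⇔ sameSign =
  shift s , cong₂ _,_ (unit s) refl , shift-⊕ s , shift-mulR t n s , shift-bijective s ,
  subst (+ 0 <_) (sym (orientation s)) (+<+ (ℕ.s≤s ℕ.z≤n)) , ∈⇔ , sameSign
  where
  unit : ∀ s → + 1 + s * + 0 ≡ + 1
  unit = solve-∀
  orientation : ∀ s → (+ 1 + s * + 0) * + 1 - + 0 * (+ 0 + s * + 1) ≡ + 1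
  orientation = solve-∀

orientedUnitalSurjection⇒shift : ∀ (f : Elt → Elt) → f oneR ≡ oneR →
  (∀ x y → f (x ⊕ y) ≡ f x ⊕ f y) → Surjective _≡_ _≡_ f → + 0 < det (f oneR) (f xR) →
  ∀ w → f w ≡ shift (proj₁ (f xR)) w
orientedUnitalSurjection⇒shift f f-one f-⊕ f-surjective orientation (u , v) = begin
  f (u , v)                              ≡⟨ linear u v ⟩
  (u * + 1 + v * s , u * + 0 + v * e)    ≡⟨ cong (λ e → (u * + 1 + v * s , u * + 0 + v * e)) e≡1 ⟩
  (u * + 1 + v * s , u * + 0 + v * + 1)  ≡⟨ cong₂ _,_ (coordinate₁ u v s) (coordinate₂ u v) ⟩
  (u + s * v , v)                        ∎
  where
  s = proj₁ (f xR)
  e = proj₂ (f xR)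
  linear : ∀ u v → f (u , v) ≡ (u * + 1 + v * s , u * + 0 + v * e)
  linear u v = trans (additive⇒linear f f-⊕ u v) (cong (λ o → (u · o) ⊕ (v · f xR)) f-one)
  coordinate₁ : ∀ u v s → u * + 1 + v * s ≡ u + s * v
  coordinate₁ = solve-∀
  coordinate₂ : ∀ u v → u * + 0 + v * + 1 ≡ v
  coordinate₂ = solve-∀
  det-oneR : ∀ s e → + 1 * e - + 0 * s ≡ e
  det-oneR = solve-∀
  e-positive : + 0 < e
  e-positive = subst (+ 0 <_) (det-oneR s e) (subst (λ o → + 0 < det o (f xR)) f-one orientation)
  preimage = proj₁ (f-surjective xR)
  z₁ = proj₁ preimage
  z₂ = proj₂ preimage
  drop : ∀ z₁ z₂ e → z₁ * + 0 + z₂ * e ≡ z₂ * e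
  drop = solve-∀
  e∣1 : e ∣ + 1
  e∣1 = divides z₂ (begin
    + 1                  ≡⟨ cong proj₂ (proj₂ (f-surjective xR) refl) ⟨
    proj₂ (f preimage)   ≡⟨ cong proj₂ (linear z₁ z₂) ⟩
    z₁ * + 0 + z₂ * e    ≡⟨ drop z₁ z₂ e ⟩
    z₂ * e               ∎)
  e≡1 : e ≡ + 1
  e≡1 = positive-∣1⇒≡1 e-positive e∣1

lower : ℤ → Mat
lower γ = mat (+ 1) (+ 0) γ (+ 1)

lower-InB2' : ∀ γ → InB2' (lower γ)
lower-InB2' γ = refl , +<+ (ℕ.s≤s ℕ.z≤n) , +<+ (ℕ.s≤s ℕ.z≤n) , unimodular γ
  where
  unimodular : ∀ γ → + 1 * + 1 - + 0 * γ ≡ + 1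
  unimodular = solve-∀

InB2'⇒lower : ∀ g → InB2' g → g ≡ lower (mγ g)
InB2'⇒lower (mat α _ γ δ) (refl , α-positive , δ-positive , unimodular) =
  cong₂ (λ α δ → mat α (+ 0) γ δ)
    (positive-∣1⇒≡1 α-positive (divides δ (sym (trans (*-comm δ α) αδ≡1))))
    (positive-∣1⇒≡1 δ-positive (divides α (sym αδ≡1)))
  where
  drop : ∀ α δ γ → α * δ - + 0 * γ ≡ α * δ
  drop = solve-∀
  αδ≡1 : α * δ ≡ + 1
  αδ≡1 = trans (sym (drop α δ γ)) unimodular

shear : ℤ → Form → Form
shear γ (form a b c) = form a (b + + 2 * (a * γ)) (c + b * γ + a * (γ * γ))

act-lower : ∀ γ Q → act (lower γ) Q ≡ shear γ Q
act-lower γ (form a b c) = cong₂ (λ a (b , c) → form a b c) (coefficient-a a b c)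
  (cong₂ _,_ (coefficient-b a b c γ) (coefficient-c a b c γ))
  where
  coefficient-a : ∀ a b c → a * (+ 1 * + 1) + b * (+ 1 * + 0) + c * (+ 0 * + 0) ≡ a
  coefficient-a = solve-∀
  coefficient-b : ∀ a b c γ →
    + 2 * (a * (+ 1 * γ)) + b * (+ 1 * + 1 + + 0 * γ) + + 2 * (c * (+ 0 * + 1)) ≡ b + + 2 * (a * γ)
  coefficient-b = solve-∀
  coefficient-c : ∀ a b c γ →
    a * (γ * γ) + b * (γ * + 1) + c * (+ 1 * + 1) ≡ c + b * γ + a * (γ * γ)
  coefficient-c = solve-∀

formToPair-valid : ∀ Q → ValidForm Q → ValidPair (formToPair Q)
formToPair-valid Q@(form a b c) (disc≢0 , a≢0) =
  disc≢0 ∘ trans (discR≡discF b (a * c)) ,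
  a≢0 ∘ trans (sym (det-formToPair Q)) ,
  ideal , oneR , generatedByOne
  where
  discR≡discF : ∀ b n → b * b - + 4 * n ≡ (- b) * (- b) - + 4 * n
  discR≡discF = solve-∀
  ideal : IsIdeal (formToPair Q)
  ideal (r₁ , r₂) (u , v) uv∈ = Equivalence.from (∈formToPair⇔∣ Q _ _)
    (∣m∣n⇒∣m-n (∣n⇒∣m*n r₁ (Equivalence.to (∈formToPair⇔∣ Q u v) uv∈))
               (∣m⇒∣m*n (r₂ * v) (∣m⇒∣m*n c ∣-refl)))
  vanishes : ∀ u a → u + (- + 1) * (u * + 1) ≡ + 0 * a
  vanishes = solve-∀
  generatedByOne : ∀ s → ∃[ k ] ((s ⊖ (k · oneR)) ∈I formToPair Q)
  generatedByOne (u , v) = u , Equivalence.from (∈formToPair⇔∣ Q _ _) (divides (+ 0) (vanishes u a))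

shear-pairIso : ∀ γ Q → a Q ≢ + 0 → PairIso (formToPair Q) (formToPair (shear γ Q))
shear-pairIso γ Q@(form a b c) a≢0 =
  shift-pairIso {formToPair Q} {formToPair (shear γ Q)} (a * γ) (trace a b γ) (norm a b c γ) ∈⇔
    (sameSign-refl (a≢0 ∘ trans (sym (det-formToPair Q))))
  where
  trace : ∀ a b γ → - (b + + 2 * (a * γ)) ≡ - b - (a * γ + a * γ)
  trace = solve-∀
  norm : ∀ a b c γ → a * (c + b * γ + a * (γ * γ)) ≡ a * c - a * γ * (- b) + a * γ * (a * γ)
  norm = solve-∀
  ∈⇔ : ∀ w → (w ∈I formToPair Q) ⇔ (shift (a * γ) w ∈I formToPair (shear γ Q))
  ∈⇔ (u , v) = ⇔-sym (∈formToPair⇔∣ (shear γ Q) _ v)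
           ⇔-∘ (∣⇔∣+ (a * γ * v) (∣m⇒∣m*n v (∣m⇒∣m*n γ ∣-refl))
           ⇔-∘ ∈formToPair⇔∣ Q u v)

formEquiv⇒pairIso : ∀ Q Q' → ValidForm Q → FormEquiv Q Q' → PairIso (formToPair Q) (formToPair Q')
formEquiv⇒pairIso Q _ (_ , a≢0) (g , g∈B2' , refl) =
  subst (PairIso (formToPair Q) ∘ formToPair) (sym act≡shear) (shear-pairIso (mγ g) Q a≢0)
  where
  act≡shear : act g Q ≡ shear (mγ g) Q
  act≡shear = trans (cong (λ g → act g Q) (InB2'⇒lower g g∈B2')) (act-lower (mγ g) Q)

shear≡ : ∀ {a b c a' b' c' s} γ → a ≢ + 0 → a ≡ a' → s ≡ γ * a →
         - b - (s + s) ≡ - b' → a * c - s * (- b) + s * s ≡ a' * c' →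
         shear γ (form a b c) ≡ form a' b' c'
shear≡ {a} {b} {c} {_} {b'} {c'} γ a≢0 refl refl trace-eq norm-eq = cong₂ (form a)
  (neg-injective (trans (trace a b γ) trace-eq))
  (*-cancelˡ-≡ a _ c' {{≢-nonZero a≢0}} (trans (norm a b c γ) norm-eq))
  where
  trace : ∀ a b γ → - (b + + 2 * (a * γ)) ≡ - b - (γ * a + γ * a)
  trace = solve-∀
  norm : ∀ a b c γ → a * (c + b * γ + a * (γ * γ)) ≡ a * c - γ * a * (- b) + γ * a * (γ * a)
  norm = solve-∀

pairIso⇒formEquiv : ∀ Q Q' → ValidForm Q → PairIso (formToPair Q) (formToPair Q') → FormEquiv Q Q'
pairIso⇒formEquiv Q@(form a b c) Q'@(form a' b' c') (_ , a≢0)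
  (f , f-one , f-⊕ , f-mulR , (_ , f-surjective) , orientation , f-∈ , sameSign) =
  lower γ , lower-InB2' γ , trans (act-lower γ Q) (shear≡ γ a≢0 a≡a' s≡γa trace-eq norm-eq)
  where
  s = proj₁ (f xR)
  f≡shift : ∀ w → f w ≡ shift s w
  f≡shift = orientedUnitalSurjection⇒shift f f-one f-⊕ f-surjective orientation

  ∣⇔∣-shift : ∀ u v → a ∣ u ⇔ a' ∣ u + s * v
  ∣⇔∣-shift u v = ∈formToPair⇔∣ Q' (u + s * v) v
      ⇔-∘ (subst-⇔ (_∈I formToPair Q') (f≡shift (u , v))
      ⇔-∘ (f-∈ (u , v) ⇔-∘ ⇔-sym (∈formToPair⇔∣ Q u v)))
  drop : ∀ u s → u + s * + 0 ≡ u
  drop = solve-∀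
  lift : ∀ s → + 0 + s * + 1 ≡ s
  lift = solve-∀

  a≡a' : a ≡ a'
  a≡a' = ∣-antisym-sameSign (subst₂ SameSign (det-formToPair Q) (det-formToPair Q') sameSign)
    (Equivalence.from (∣⇔∣-shift a' (+ 0)) (subst (a' ∣_) (sym (drop a' s)) ∣-refl))
    (subst (a' ∣_) (drop a s) (Equivalence.to (∣⇔∣-shift a (+ 0)) ∣-refl))
  a'∣s : a' ∣ s
  a'∣s = subst (a' ∣_) (lift s) (Equivalence.to (∣⇔∣-shift (+ 0) (+ 1)) (divides (+ 0) refl))
  γ = _∣_.quotient a'∣s
  s≡γa : s ≡ γ * a
  s≡γa = trans (_∣_.equality a'∣s) (cong (γ *_) (sym a≡a'))

  squares : mulR (- b - (s + s)) (a * c - s * (- b) + s * s) (shift s xR) (shift s xR)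
          ≡ mulR (- b') (a' * c') (shift s xR) (shift s xR)
  squares = begin
    mulR (- b - (s + s)) (a * c - s * (- b) + s * s) (shift s xR) (shift s xR)
      ≡⟨ shift-mulR (- b) (a * c) s xR xR ⟨
    shift s (mulR (- b) (a * c) xR xR)   ≡⟨ f≡shift _ ⟨
    f (mulR (- b) (a * c) xR xR)         ≡⟨ f-mulR xR xR ⟩
    mulR (- b') (a' * c') (f xR) (f xR)  ≡⟨ cong (λ x → mulR (- b') (a' * c') x x) (f≡shift xR) ⟩
    mulR (- b') (a' * c') (shift s xR) (shift s xR) ∎
  structure-eq : - b - (s + s) ≡ - b' × a * c - s * (- b) + s * s ≡ a' * c'
  structure-eq = mulR-square-injective (+ 0 + s * + 1) squares
  trace-eq = proj₁ structure-eq
  norm-eq = proj₂ structure-eq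

-- Writing w₁ = 1 - mG, w₂ = s - jG and w₃ = G² - kG for the elements of I given by
-- cyclicity, s - jk = w₂ + j (G w₁ + m w₃ - k w₁).
cyclicQuotient⇒generatedByOne : ∀ P → IsIdeal P → CyclicQuotient P →
                                ∀ s → ∃[ k ] ((s ⊖ (k · oneR)) ∈I P)
cyclicQuotient⇒generatedByOne P@(pair t n _ _) ideal (G@(gu , gv) , generates) (su , sv) =
  j * k , subst (_∈I P) (sym (combination t n su sv gu gv j k m))
    (∈span-⊕ w₂∈ (∈span-· j (∈span-⊕ (∈span-⊕ (ideal G _ w₁∈) (∈span-· m w₃∈)) (∈span-· (- k) w₁∈))))
  where
  m = proj₁ (generates oneR)
  w₁∈ = proj₂ (generates oneR)
  j = proj₁ (generates (su , sv))
  w₂∈ = proj₂ (generates (su , sv))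
  k = proj₁ (generates (mulR t n G G))
  w₃∈ = proj₂ (generates (mulR t n G G))

  coordinate₁ : ∀ t n su gu gv j k m →
    let w₁u = + 1 + (- + 1) * (m * gu)
        w₁v = + 0 + (- + 1) * (m * gv)
        w₃u = gu * gu - n * (gv * gv) + (- + 1) * (k * gu)
    in su + (- + 1) * ((j * k) * + 1)
       ≡ su + (- + 1) * (j * gu) + j * ((gu * w₁u - n * (gv * w₁v) + m * w₃u) + (- k) * w₁u)
  coordinate₁ = solve-∀
  coordinate₂ : ∀ t n sv gu gv j k m →
    let w₁u = + 1 + (- + 1) * (m * gu)
        w₁v = + 0 + (- + 1) * (m * gv)
        w₃v = gu * gv + gu * gv + t * (gv * gv) + (- + 1) * (k * gv)
    in sv + (- + 1) * ((j * k) * + 0)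
       ≡ sv + (- + 1) * (j * gv) + j * ((gu * w₁v + w₁u * gv + t * (gv * w₁v) + m * w₃v) + (- k) * w₁v)
  coordinate₂ = solve-∀
  combination : ∀ t n su sv gu gv j k m → let G = (gu , gv) ; w₁ = oneR ⊖ (m · G) in
    (su , sv) ⊖ ((j * k) · oneR)
    ≡ ((su , sv) ⊖ (j · G)) ⊕ (j · ((mulR t n G w₁ ⊕ (m · (mulR t n G G ⊖ (k · G)))) ⊕ ((- k) · w₁)))
  combination t n su sv gu gv j k m =
    cong₂ _,_ (coordinate₁ t n su gu gv j k m) (coordinate₂ t n sv gu gv j k m)

cyclicQuotient⇒r+x∈I : ∀ P → IsIdeal P → CyclicQuotient P → ∃[ r ] ((r , + 1) ∈I P)
cyclicQuotient⇒r+x∈I P ideal cyclic = r+x∈ (cyclicQuotient⇒generatedByOne P ideal cyclic xR)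
  where
  coordinate₁ : ∀ k → + 0 + (- + 1) * (k * + 1) ≡ - k
  coordinate₁ = solve-∀
  coordinate₂ : ∀ k → + 1 + (- + 1) * (k * + 0) ≡ + 1
  coordinate₂ = solve-∀
  r+x∈ : ∃[ k ] ((xR ⊖ (k · oneR)) ∈I P) → ∃[ r ] ((r , + 1) ∈I P)
  r+x∈ (k , x-k∈) = - k , subst (_∈I P) (cong₂ _,_ (coordinate₁ k) (coordinate₂ k)) x-k∈

-- (t + r) - x is the conjugate of r + x.
det∣norm : ∀ P r → IsIdeal P → (r , + 1) ∈I P → det (g₁ P) (g₂ P) ∣ r * r + r * pt P + pn P
det∣norm P@(pair t n _ _) r ideal r+x∈ = subst (det (g₁ P) (g₂ P) ∣_) (norm t n r)
  (Equivalence.to (∈span⇔∣ r+x∈ _ _) (ideal (t + r , - + 1) (r , + 1) r+x∈))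
  where
  norm : ∀ t n r →
    (t + r) * r - n * ((- + 1) * + 1) - r * ((t + r) * + 1 + r * (- + 1) + t * ((- + 1) * + 1))
    ≡ r * r + r * t + n
  norm = solve-∀

discF-translate : ∀ t n r D c → r * r + r * t + n ≡ D * c →
                  discF (form D (- (t + (r + r))) c) ≡ discR t n
discF-translate t n r D c norm≡ = begin
  (- (t + (r + r))) * (- (t + (r + r))) - + 4 * (D * c)
    ≡⟨ cong (λ N → (- (t + (r + r))) * (- (t + (r + r))) - + 4 * N) norm≡ ⟨
  (- (t + (r + r))) * (- (t + (r + r))) - + 4 * (r * r + r * t + n)
    ≡⟨ disc t n r ⟩
  t * t - + 4 * n ∎
  where
  disc : ∀ t n r → (- (t + (r + r))) * (- (t + (r + r))) - + 4 * (r * r + r * t + n) ≡ t * t - + 4 * n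
  disc = solve-∀

r+x∈I⇒preimage : ∀ {P r} → discR (pt P) (pn P) ≢ + 0 → det (g₁ P) (g₂ P) ≢ + 0 →
  (r , + 1) ∈I P → det (g₁ P) (g₂ P) ∣ r * r + r * pt P + pn P →
  ∃[ Q ] (ValidForm Q × PairIso (formToPair Q) P)
r+x∈I⇒preimage {P@(pair t n g₁ g₂)} {r} disc≢0 det≢0 r+x∈ (divides c N≡cD) =
  Q , (disc≢0 ∘ trans (sym (discF-translate t n r D c norm≡)) , det≢0) , iso
  where
  D = det g₁ g₂
  norm≡ : r * r + r * t + n ≡ D * c
  norm≡ = trans N≡cD (*-comm c D)
  Q = form D (- (t + (r + r))) c

  trace : ∀ t r → t ≡ - (- (t + (r + r))) - (r + r)
  trace = solve-∀
  norm : ∀ t n r → n ≡ (r * r + r * t + n) - r * (- (- (t + (r + r)))) + r * r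
  norm = solve-∀
  ∈⇔ : ∀ w → (w ∈I formToPair Q) ⇔ (shift r w ∈I P)
  ∈⇔ (u , v) = ⇔-sym (∈span⇔∣ r+x∈ (u + r * v) v)
           ⇔-∘ (subst-⇔ (D ∣_) (cancel u r v) ⇔-∘ ∈formToPair⇔∣ Q u v)
    where
    cancel : ∀ u r v → u ≡ u + r * v - r * v
    cancel = solve-∀
  iso : PairIso (formToPair Q) P
  iso = shift-pairIso {formToPair Q} {P} r (trace t r)
    (trans (norm t n r) (cong (λ N → N - r * (- (- (t + (r + r)))) + r * r) norm≡)) ∈⇔
    (subst (λ d → SameSign d D) (sym (det-formToPair Q)) (sameSign-refl det≢0))

validPair⇒preimage : ∀ P → ValidPair P → ∃[ Q ] (ValidForm Q × PairIso (formToPair Q) P)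
validPair⇒preimage P (disc≢0 , det≢0 , ideal , cyclic) =
  r+x∈I⇒preimage disc≢0 det≢0 r+x∈ (det∣norm P r ideal r+x∈)
  where
  r = proj₁ (cyclicQuotient⇒r+x∈I P ideal cyclic)
  r+x∈ = proj₂ (cyclicQuotient⇒r+x∈I P ideal cyclic)

proposition5p1 :
    (∀ Q → ValidForm Q → ValidPair (formToPair Q))
    × (∀ Q Q' → ValidForm Q → ValidForm Q' →
         FormEquiv Q Q' → PairIso (formToPair Q) (formToPair Q'))
    × (∀ Q Q' → ValidForm Q → ValidForm Q' →
         PairIso (formToPair Q) (formToPair Q') → FormEquiv Q Q')
    × (∀ P → ValidPair P → ∃[ Q ] (ValidForm Q × PairIso (formToPair Q) P))
proposition5p1 =
  formToPair-valid ,
  (λ Q Q' valid _ → formEquiv⇒pairIso Q Q' valid) ,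
  (λ Q Q' valid _ → pairIso⇒formEquiv Q Q' valid) ,
  validPair⇒preimage
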